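{- Let $G$ and $H$ be graphs with $\mathrm{oh}(G)=s\geq 2$ and $\mathrm{oh}(H)=t\geq 2$. Then $\mathrm{oh}(G\square H)\geq s+t-2$.
   Context: All graphs are finite, simple and loopless. $\mathrm{oh}(G)$ (Odd Hadwiger number) is the largest integer $m$ for which there exist $m$ pairwise vertex-disjoint trees $Z_1,\dots,Z_m$ in $G$ and a 2-colouring $c$ of $V(Z_1)\cup\dots\cup V(Z_m)$ that is proper on each $Z_k$, such that for every $k\neq k'$ there is an edge $xy\in E(G)$ with $x\in V(Z_k)$, $y\in V(Z_{k'})$, $c(x)=c(y)$. The Cartesian product $G\square H$ has vertex set $V(G)\times V(H)$, with $(v_1,u_1)\sim(v_2,u_2)$ iff ($v_1=v_2$ and $u_1u_2\in E(H)$) or ($u_1=u_2$ and $v_1v_2\in E(G)$). -}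

module Defs where

open import Level using (0ℓ)
open import Data.Nat using (ℕ; _≤_; _*_)
open import Data.Fin using (Fin)
open import Data.Fin.Properties using (*↔×)
open import Data.Bool using (Bool)
open import Data.List using (List; []; _∷_; _∷ʳ_; length)
open import Data.List.Relation.Unary.Unique.Propositional using (Unique)
open import Data.Product using (Σ; ∃; _×_; _,_)
open import Data.Product.Function.NonDependent.Propositional using (_×-↔_)
open import Data.Sum using (_⊎_)
open import Data.Unit using (⊤)
open import Data.Empty using (⊥)
open import Function.Bundles using (_↔_)
open import Function.Properties.Inverse using (↔-trans; ↔-sym)
open import Relation.Nullary using (¬_)
open import Relation.Binary.PropositionalEquality using (_≡_; _≢_)
open import Relation.Binary.Construct.Closure.ReflexiveTransitive using (Star)

record Graph : Set₁ where
  field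
    V      : Set
    size   : ℕ
    finite : V ↔ Fin size
    Adj    : V → V → Set
    sym    : ∀ {u v} → Adj u v → Adj v u
    irrefl : ∀ {v} → ¬ Adj v v

open Graph public

module _ (G H : Graph) where
  open import Data.Sum using (inj₁; inj₂)
  open import Relation.Binary.PropositionalEquality using () renaming (sym to ≡-sym)

  □Adj : V G × V H → V G × V H → Set
  □Adj (v₁ , u₁) (v₂ , u₂) = (v₁ ≡ v₂ × Adj H u₁ u₂) ⊎ (u₁ ≡ u₂ × Adj G v₁ v₂)

  □sym : ∀ {x y} → □Adj x y → □Adj y x
  □sym {v₁ , u₁} {v₂ , u₂} (inj₁ (e , a)) = inj₁ (≡-sym e , Graph.sym H a)
  □sym {v₁ , u₁} {v₂ , u₂} (inj₂ (e , a)) = inj₂ (≡-sym e , Graph.sym G a)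

  □irrefl : ∀ {x} → ¬ □Adj x x
  □irrefl {v , u} (inj₁ (_ , a)) = Graph.irrefl H a
  □irrefl {v , u} (inj₂ (_ , a)) = Graph.irrefl G a

_□_ : Graph → Graph → Graph
G □ H = record
  { V      = V G × V H
  ; size   = size G * size H
  ; finite = ↔-trans (finite G ×-↔ finite H) (↔-sym *↔×)
  ; Adj    = □Adj G H
  ; sym    = □sym G H
  ; irrefl = □irrefl G H
  }

module _ {V : Set} where

  Chain : (V → V → Set) → V → List V → Set
  Chain E x []       = ⊤
  Chain E x (y ∷ ys) = E x y × Chain E y ys

  HasCycle : (V → V → Set) → Set
  HasCycle E = Σ V λ x → Σ (List V) λ ys → Σ V λ z →
    (1 ≤ length ys) × Unique ((x ∷ ys) ∷ʳ z) × Chain E x (ys ∷ʳ z) × E z x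

  record IsTree (S : V → Set) (E : V → V → Set) : Set where
    field
      inside    : ∀ {u v} → E u v → S u × S v
      symmetric : ∀ {u v} → E u v → E v u
      loopless  : ∀ {v} → ¬ E v v
      nonempty  : ∃ S
      connected : ∀ {u v} → S u → S v → Star E u v
      acyclic   : ¬ HasCycle E

-- An odd K_m model in G: pairwise vertex-disjoint trees Z₁,…,Z_m of G
-- (tree edges are edges of G) and a 2-colouring proper on each Z_k such
-- that any two distinct trees are joined by a monochromatic edge of G.
-- (The colouring is given on all of V(G); only its values on the trees matter.)

record OddModel (G : Graph) (m : ℕ) : Set₁ where
  field
    inZ      : Fin m → V G → Set
    treeE    : Fin m → V G → V G → Set
    colour   : V G → Bool
    isTree   : ∀ k → IsTree (inZ k) (treeE k)
    subgraph : ∀ k {u v} → treeE k u v → Adj G u v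
    disjoint : ∀ {k k' v} → inZ k v → inZ k' v → k ≡ k'
    proper   : ∀ k {u v} → treeE k u v → colour u ≢ colour v
    oddEdge  : ∀ {k k'} → k ≢ k' →
               Σ (V G) λ x → Σ (V G) λ y →
                 inZ k x × inZ k' y × Adj G x y × colour x ≡ colour y

OhEq : Graph → ℕ → Set₁
OhEq G s = OddModel G s × (∀ m → OddModel G m → m ≤ s)

OhGeq : Graph → ℕ → Set₁
OhGeq G k = Σ ℕ λ m → k ≤ m × OddModel G m

-- Let X₀,…,Xₘ and Y₀,…,Yₙ be odd models in G and H. For i ≥ 1 pick a monochromatic
-- edge from a foot zᵢ ∈ Xᵢ to X₀, similarly wⱼ ∈ Yⱼ, and fix roots v₀ ∈ X₀, u₀ ∈ Y₀.
-- Let T be Y₀ with each wⱼ attached as a leaf to its partner in Y₀. The m + n trees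
--   Aᵢ = Xᵢ × {u₀} ∪ {zᵢ} × T   and   Bⱼ = X₀ × {wⱼ} ∪ {v₀} × Yⱼ
-- are disjoint, any two are joined by an edge, and the product colouring
-- c(x, y) = c(x) + c(y) becomes a valid odd colouring once it is flipped on
-- F = {v₀} × V(H) ∪ V(G) × {w₁,…,wₙ}: this makes the leaf edges of T proper, while
-- every Bⱼ lies inside F and every other edge used has both ends on the same side of F.
module Submission where

open import Defs hiding (sym)
open import Algebra.Bundles using (CommutativeRing)
open import Data.Bool using (Bool; true; false; _xor_; _∨_)
open import Data.Bool.Properties using (xor-∧-commutativeRing; ∨-zeroʳ)
open import Algebra.Properties.Group (CommutativeRing.+-group xor-∧-commutativeRing)
  using (∙-cancelˡ; ∙-cancelʳ)
open import Data.Nat using (ℕ; zero; suc; _≤_; _+_; _∸_; s≤s)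
open import Data.Nat.Properties using (≤-reflexive; +-suc)
open import Data.Fin using (Fin; zero; suc)
open import Data.Fin.Properties using (suc-injective; any?; inj⇒≟; +↔⊎)
open import Data.List using (List; []; _∷_; _∷ʳ_; length; map)
open import Data.List.Properties using (length-map; map-++; map-∘; map-id-local)
open import Data.List.Relation.Unary.All using (All; []; _∷_)
open import Data.List.Relation.Unary.All.Properties using (∷ʳ⁻)
open import Data.List.Relation.Unary.AllPairs using ([]; _∷_)
open import Data.List.Relation.Unary.Unique.Propositional using (Unique)
open import Data.List.Relation.Unary.Unique.Propositional.Properties using (map⁻)
open import Data.Product using (Σ; ∃; _×_; _,_; proj₁; proj₂) renaming (map to ×-map)
open import Data.Sum using (_⊎_; inj₁; inj₂; [_,_]; swap) renaming (map to ⊎-map)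
open import Data.Unit using (tt)
open import Data.Empty using (⊥; ⊥-elim)
open import Function using (id; _∘_)
open import Function.Bundles using (Injection; Inverse)
open import Function.Definitions using (Injective)
open import Function.Properties.Inverse using (↔⇒↣)
open import Relation.Nullary using (¬_; does)
open import Relation.Nullary.Decidable using (dec-true; dec-false)
open import Relation.Unary using (_∪_; _⊆_)
open import Relation.Binary using (_⇒_; DecidableEquality)
open import Relation.Binary.PropositionalEquality
  using (_≡_; _≢_; refl; sym; trans; cong; cong₂; subst; subst₂)
open import Relation.Binary.Construct.Closure.ReflexiveTransitive
  using (Star; ε; _◅_; _◅◅_; gmap) renaming (map to Star-map)

Chain-map : ∀ {A B : Set} {E : A → A → Set} {E′ : B → B → Set} (g : B → A) →
                (∀ {b b′} → E′ b b′ → E (g b) (g b′)) →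
                ∀ {c} L → Chain E′ c L → Chain E (g c) (map g L)
Chain-map g h []      _        = tt
Chain-map g h (_ ∷ L) (e , es) = h e , Chain-map g h L es

Chain-targets : ∀ {A : Set} {E : A → A → Set} {P : A → Set} →
                (∀ {a b} → E a b → P b) → ∀ {c} L → Chain E c L → All P L
Chain-targets h []      _        = []
Chain-targets h (_ ∷ L) (e , es) = h e ∷ Chain-targets h L es

-- f ∘ g fixes every vertex entered by an E′-edge, hence every vertex of a cycle, so g is injective there.
HasCycle-map : ∀ {A B : Set} {E : A → A → Set} {E′ : B → B → Set} (f : A → B) (g : B → A) →
                   (∀ {b b′} → E′ b b′ → E (g b) (g b′) × f (g b′) ≡ b′) →
                   HasCycle E′ → HasCycle E
HasCycle-map {B = B} {E = E} f g h (x , ys , z , 1≤ys , unique , chain , closing) =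
  g x , map g ys , g z ,
  subst (1 ≤_) (sym (length-map g ys)) 1≤ys ,
  subst Unique (cong (g x ∷_) (map-++ g ys (z ∷ []))) unique′ ,
  subst (Chain E (g x)) (map-++ g ys (z ∷ [])) (Chain-map g (proj₁ ∘ h) (ys ∷ʳ z) chain) ,
  proj₁ (h closing)
  where
    cycle : List B
    cycle = x ∷ ys ∷ʳ z
    fg-fixes-cycle : map f (map g cycle) ≡ cycle
    fg-fixes-cycle = trans (sym (map-∘ cycle))
      (map-id-local (proj₂ (h closing) ∷ Chain-targets (proj₂ ∘ h) (ys ∷ʳ z) chain))
    unique′ : Unique (map g cycle)
    unique′ = map⁻ (subst Unique (sym fg-fixes-cycle) unique)

module _ {X : Set} where

  IsTree-cong : ∀ {S S′ : X → Set} {E E′ : X → X → Set} →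
                S ⊆ S′ → S′ ⊆ S → E ⇒ E′ → E′ ⇒ E → IsTree S E → IsTree S′ E′
  IsTree-cong S⊆S′ S′⊆S E⇒E′ E′⇒E T = record
    { inside    = λ e → let (u , v) = inside (E′⇒E e) in S⊆S′ u , S⊆S′ v
    ; symmetric = E⇒E′ ∘ symmetric ∘ E′⇒E
    ; loopless  = loopless ∘ E′⇒E
    ; nonempty  = let (v , v∈S) = nonempty in v , S⊆S′ v∈S
    ; connected = λ u v → Star-map E⇒E′ (connected (S′⊆S u) (S′⊆S v))
    ; acyclic   = acyclic ∘ HasCycle-map id id (λ e → E′⇒E e , refl)
    }
    where open IsTree T

module _ {A B : Set} (f : A → B) where

  Image : (A → Set) → B → Set
  Image S b = Σ A λ a → S a × f a ≡ b

  ImageRel : (A → A → Set) → B → B → Set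
  ImageRel E b b′ = Σ A λ a → Σ A λ a′ → E a a′ × f a ≡ b × f a′ ≡ b′

  IsTree-image : ∀ {S E} (g : B → A) → (∀ a → g (f a) ≡ a) →
                 IsTree S E → IsTree (Image S) (ImageRel E)
  IsTree-image {S} {E} g g∘f≗id T = record
    { inside    = λ { (a , a′ , e , refl , refl) →
                      let (u , v) = inside e in (a , u , refl) , (a′ , v , refl) }
    ; symmetric = λ { (a , a′ , e , p , q) → a′ , a , symmetric e , q , p }
    ; loopless  = λ { (a , a′ , e , refl , q) → loopless (subst (E a) (f-injective q) e) }
    ; nonempty  = let (a , a∈S) = nonempty in f a , a , a∈S , refl
    ; connected = λ { (a , u , refl) (a′ , v , refl) →
                      gmap f (λ e → _ , _ , e , refl , refl) (connected u v) }
    ; acyclic   = acyclic ∘ HasCycle-map f g retract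
    }
    where
      open IsTree T
      f-injective : ∀ {a a′} → f a ≡ f a′ → a ≡ a′
      f-injective {a} {a′} eq = trans (sym (g∘f≗id a)) (trans (cong g eq) (g∘f≗id a′))
      retract : ∀ {b b′} → ImageRel E b b′ → E (g b) (g b′) × f (g b′) ≡ b′
      retract (a , a′ , e , refl , refl) =
        subst₂ E (sym (g∘f≗id a)) (sym (g∘f≗id a′)) e , cong f (g∘f≗id a′)

module _ {X : Set} where

  EndsIn : (X → Set) → X → List X → Set
  EndsIn S c []      = S c
  EndsIn S c (y ∷ L) = EndsIn S y L

  EndsIn-∷ʳ : ∀ {S : X → Set} c L {z} → S z → EndsIn S c (L ∷ʳ z)
  EndsIn-∷ʳ c []      z∈S = z∈S
  EndsIn-∷ʳ c (y ∷ L) z∈S = EndsIn-∷ʳ y L z∈S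

module Gluing {X : Set} {E E₁ E₂ : X → X → Set} {S₁ S₂ : X → Set} (p : X)
  (split : ∀ {a b} → E a b → E₁ a b ⊎ E₂ a b)
  (inside₁ : ∀ {a b} → E₁ a b → S₁ a × S₁ b)
  (inside₂ : ∀ {a b} → E₂ a b → S₂ a × S₂ b)
  (meet : ∀ {v} → S₁ v → S₂ v → v ≡ p)
  where

  walk-from-S₂-to-S₁-visits-p : ∀ {c} L → Chain E c L → S₂ c → All (p ≢_) (c ∷ L) → ¬ EndsIn S₁ c L
  walk-from-S₂-to-S₁-visits-p []      _        c∈S₂ (p≢c ∷ _) c∈S₁ = p≢c (sym (meet c∈S₁ c∈S₂))
  walk-from-S₂-to-S₁-visits-p (y ∷ L) (e , es) c∈S₂ (p≢c ∷ p∉L) end with split e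
  ... | inj₁ e₁ = p≢c (sym (meet (proj₁ (inside₁ e₁)) c∈S₂))
  ... | inj₂ e₂ = walk-from-S₂-to-S₁-visits-p L es (proj₂ (inside₂ e₂)) p∉L end

  -- A path can only get from S₁ to S₂ and back through p, and it cannot visit p twice.
  path-within-S₁ : ∀ {c} L → Chain E c L → Unique (c ∷ L) → S₁ c → EndsIn S₁ c L → Chain E₁ c L
  path-within-S₁ []      _        _           _    _   = tt
  path-within-S₁ (y ∷ L) (e , es) (c∉L ∷ distinct) c∈S₁ end with split e
  ... | inj₁ e₁ = e₁ , path-within-S₁ L es distinct (proj₂ (inside₁ e₁)) end
  ... | inj₂ e₂ = ⊥-elim (walk-from-S₂-to-S₁-visits-p L es (proj₂ (inside₂ e₂)) p∉L end)
    where
      p∉L : All (p ≢_) (y ∷ L)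
      p∉L = subst (λ c → All (c ≢_) (y ∷ L)) (meet c∈S₁ (proj₁ (inside₂ e₂))) c∉L

  cycle-within-E₁ : ∀ x ys z → 1 ≤ length ys → Unique (x ∷ ys ∷ʳ z) →
                    Chain E x (ys ∷ʳ z) → E₁ z x → HasCycle E₁
  cycle-within-E₁ x ys z 1≤ys distinct chain closing =
    x , ys , z , 1≤ys , distinct ,
    path-within-S₁ (ys ∷ʳ z) chain distinct (proj₂ (inside₁ closing))
      (EndsIn-∷ʳ x ys (proj₁ (inside₁ closing))) ,
    closing

module _ {X : Set} {S₁ S₂ : X → Set} {E₁ E₂ : X → X → Set} where

  IsTree-glue : (p : X) → S₁ p → S₂ p → (∀ {v} → S₁ v → S₂ v → v ≡ p) →
                IsTree S₁ E₁ → IsTree S₂ E₂ → IsTree (S₁ ∪ S₂) (λ a b → E₁ a b ⊎ E₂ a b)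
  IsTree-glue p p∈S₁ p∈S₂ meet T₁ T₂ = record
    { inside    = [ ×-map inj₁ inj₁ ∘ T₁.inside , ×-map inj₂ inj₂ ∘ T₂.inside ]
    ; symmetric = ⊎-map T₁.symmetric T₂.symmetric
    ; loopless  = [ T₁.loopless , T₂.loopless ]
    ; nonempty  = p , inj₁ p∈S₁
    ; connected = connected
    ; acyclic   = acyclic
    }
    where
      module T₁ = IsTree T₁
      module T₂ = IsTree T₂
      E : X → X → Set
      E a b = E₁ a b ⊎ E₂ a b
      connected : ∀ {u v} → (S₁ ∪ S₂) u → (S₁ ∪ S₂) v → Star E u v
      connected (inj₁ u) (inj₁ v) = Star-map inj₁ (T₁.connected u v)
      connected (inj₂ u) (inj₂ v) = Star-map inj₂ (T₂.connected u v)
      connected (inj₁ u) (inj₂ v) =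
        Star-map inj₁ (T₁.connected u p∈S₁) ◅◅ Star-map inj₂ (T₂.connected p∈S₂ v)
      connected (inj₂ u) (inj₁ v) =
        Star-map inj₂ (T₂.connected u p∈S₂) ◅◅ Star-map inj₁ (T₁.connected p∈S₁ v)
      acyclic : ¬ HasCycle E
      acyclic (x , ys , z , 1≤ys , distinct , chain , inj₁ closing) =
        T₁.acyclic (Gluing.cycle-within-E₁ p id T₁.inside T₂.inside meet
          x ys z 1≤ys distinct chain closing)
      acyclic (x , ys , z , 1≤ys , distinct , chain , inj₂ closing) =
        T₂.acyclic (Gluing.cycle-within-E₁ p swap T₂.inside T₁.inside (λ v₂ v₁ → meet v₁ v₂)
          x ys z 1≤ys distinct chain closing)

module _ {X : Set} where

  Pair : X → X → X → Set
  Pair a b y = y ≡ a ⊎ y ≡ b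

  Link : X → X → X → X → Set
  Link a b y y′ = (y ≡ a × y′ ≡ b) ⊎ (y ≡ b × y′ ≡ a)

  IsTree-link : ∀ {a b} → a ≢ b → IsTree (Pair a b) (Link a b)
  IsTree-link {a} {b} a≢b = record
    { inside    = inside
    ; symmetric = λ { (inj₁ (p , q)) → inj₂ (q , p) ; (inj₂ (p , q)) → inj₁ (q , p) }
    ; loopless  = λ { (inj₁ (refl , q)) → a≢b q ; (inj₂ (refl , q)) → a≢b (sym q) }
    ; nonempty  = a , inj₁ refl
    ; connected = connected
    ; acyclic   = acyclic
    }
    where
      inside : ∀ {y y′} → Link a b y y′ → Pair a b y × Pair a b y′
      inside (inj₁ (p , q)) = inj₁ p , inj₂ q
      inside (inj₂ (p , q)) = inj₂ p , inj₁ q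
      connected : ∀ {y y′} → Pair a b y → Pair a b y′ → Star (Link a b) y y′
      connected (inj₁ refl) (inj₁ refl) = ε
      connected (inj₁ refl) (inj₂ refl) = inj₁ (refl , refl) ◅ ε
      connected (inj₂ refl) (inj₁ refl) = inj₂ (refl , refl) ◅ ε
      connected (inj₂ refl) (inj₂ refl) = ε
      no-three-distinct : ∀ {x y z} → Pair a b x → Pair a b y → Pair a b z → x ≢ y → x ≢ z → y ≢ z → ⊥
      no-three-distinct (inj₁ refl) (inj₁ refl) _           x≢y _   _   = x≢y refl
      no-three-distinct (inj₂ refl) (inj₂ refl) _           x≢y _   _   = x≢y refl
      no-three-distinct (inj₁ refl) (inj₂ refl) (inj₁ refl) _   x≢z _   = x≢z refl
      no-three-distinct (inj₁ refl) (inj₂ refl) (inj₂ refl) _   _   y≢z = y≢z refl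
      no-three-distinct (inj₂ refl) (inj₁ refl) (inj₁ refl) _   _   y≢z = y≢z refl
      no-three-distinct (inj₂ refl) (inj₁ refl) (inj₂ refl) _   x≢z _   = x≢z refl
      acyclic : ¬ HasCycle (Link a b)
      acyclic (x , []     , z , () , _)
      acyclic (x , y ∷ ys , z , _ , (x∉@(x≢y ∷ _) ∷ y∉ ∷ _) , (xy , _) , zx) =
        no-three-distinct (proj₂ (inside zx)) (proj₂ (inside xy)) (proj₁ (inside zx))
          x≢y (proj₂ (∷ʳ⁻ {xs = y ∷ ys} x∉)) (proj₂ (∷ʳ⁻ {xs = ys} y∉))

module _ {X : Set} where

  WithLeaves : ∀ {n} → (X → Set) → (Fin n → X) → X → Set
  WithLeaves S leaf y = S y ⊎ ∃ λ j → y ≡ leaf j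

  WithLeavesE : ∀ {n} → (X → X → Set) → (Fin n → X) → (Fin n → X) → X → X → Set
  WithLeavesE E hub leaf y y′ = E y y′ ⊎ ∃ λ j → Link (hub j) (leaf j) y y′

module _ {X : Set} {S : X → Set} {E : X → X → Set} where

  IsTree-withLeaves : ∀ {n} (hub leaf : Fin n → X) → (∀ j → S (hub j)) → (∀ j → ¬ S (leaf j)) →
                      Injective _≡_ _≡_ leaf → IsTree S E →
                      IsTree (WithLeaves S leaf) (WithLeavesE E hub leaf)
  IsTree-withLeaves {zero} hub leaf _ _ _ T =
    IsTree-cong inj₁ (λ { (inj₁ v) → v }) inj₁ (λ { (inj₁ e) → e }) T
  IsTree-withLeaves {suc n} hub leaf hub∈S leaf∉S leaf-injective T =
    IsTree-cong to from to′ from′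
      (IsTree-glue (hub zero) (inj₁ (hub∈S zero)) (inj₁ refl) meet
        (IsTree-withLeaves (hub ∘ suc) (leaf ∘ suc) (hub∈S ∘ suc) (leaf∉S ∘ suc)
           (suc-injective ∘ leaf-injective) T)
        (IsTree-link (λ hub≡leaf → leaf∉S zero (subst S hub≡leaf (hub∈S zero)))))
    where
      Rest : X → Set
      Rest = WithLeaves S (leaf ∘ suc)
      RestE : X → X → Set
      RestE = WithLeavesE E (hub ∘ suc) (leaf ∘ suc)
      meet : ∀ {v} → Rest v → Pair (hub zero) (leaf zero) v → v ≡ hub zero
      meet _                 (inj₁ v≡hub)  = v≡hub
      meet (inj₁ v∈S)        (inj₂ refl)   = ⊥-elim (leaf∉S zero v∈S)
      meet (inj₂ (j , v≡leaf)) (inj₂ refl) with leaf-injective v≡leaf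
      ... | ()
      to : Rest ∪ Pair (hub zero) (leaf zero) ⊆ WithLeaves S leaf
      to (inj₁ (inj₁ v∈S))      = inj₁ v∈S
      to (inj₁ (inj₂ (j , eq))) = inj₂ (suc j , eq)
      to (inj₂ (inj₁ refl))     = inj₁ (hub∈S zero)
      to (inj₂ (inj₂ eq))       = inj₂ (zero , eq)
      from : WithLeaves S leaf ⊆ Rest ∪ Pair (hub zero) (leaf zero)
      from (inj₁ v∈S)           = inj₁ (inj₁ v∈S)
      from (inj₂ (zero , eq))   = inj₂ (inj₂ eq)
      from (inj₂ (suc j , eq))  = inj₁ (inj₂ (j , eq))
      to′ : ∀ {a b} → RestE a b ⊎ Link (hub zero) (leaf zero) a b → WithLeavesE E hub leaf a b
      to′ (inj₁ (inj₁ e))       = inj₁ e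
      to′ (inj₁ (inj₂ (j , e))) = inj₂ (suc j , e)
      to′ (inj₂ e)              = inj₂ (zero , e)
      from′ : ∀ {a b} → WithLeavesE E hub leaf a b → RestE a b ⊎ Link (hub zero) (leaf zero) a b
      from′ (inj₁ e)            = inj₁ (inj₁ e)
      from′ (inj₂ (zero , e))   = inj₂ e
      from′ (inj₂ (suc j , e))  = inj₁ (inj₂ (j , e))

module _ {A B : Set} where

  Cross : (A → Set) → (B → Set) → A → B → A × B → Set
  Cross S S′ a b = Image (_, b) S ∪ Image (a ,_) S′

  CrossE : (A → A → Set) → (B → B → Set) → A → B → A × B → A × B → Set
  CrossE E E′ a b u v = ImageRel (_, b) E u v ⊎ ImageRel (a ,_) E′ u v

  IsTree-cross : ∀ {S S′ E E′ a b} → S a → S′ b → IsTree S E → IsTree S′ E′ →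
                 IsTree (Cross S S′ a b) (CrossE E E′ a b)
  IsTree-cross {a = a} {b} a∈S b∈S′ T T′ =
    IsTree-glue (a , b) (a , a∈S , refl) (b , b∈S′ , refl) meet
      (IsTree-image (_, b) proj₁ (λ _ → refl) T) (IsTree-image (a ,_) proj₂ (λ _ → refl) T′)
    where
      meet : ∀ {v} → Image (_, b) _ v → Image (a ,_) _ v → v ≡ (a , b)
      meet (_ , _ , refl) (_ , _ , refl) = refl

  Cross-proj₁ : ∀ {S S′ a b v} → S a → Cross S S′ a b v → S (proj₁ v)
  Cross-proj₁ _   (inj₁ (_ , x∈S , refl)) = x∈S
  Cross-proj₁ a∈S (inj₂ (_ , _   , refl)) = a∈S

  Cross-proj₂ : ∀ {S S′ a b v} → S′ b → Cross S S′ a b v → S′ (proj₂ v)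
  Cross-proj₂ b∈S′ (inj₁ (_ , _    , refl)) = b∈S′
  Cross-proj₂ _    (inj₂ (_ , y∈S′ , refl)) = y∈S′

CrossE-□ : ∀ {G H : Graph} {E E′ a b} → E ⇒ Adj G → E′ ⇒ Adj H → CrossE E E′ a b ⇒ Adj (G □ H)
CrossE-□ E⇒G E′⇒H (inj₁ (_ , _ , e , refl , refl)) = inj₂ (refl , E⇒G e)
CrossE-□ E⇒G E′⇒H (inj₂ (_ , _ , e , refl , refl)) = inj₁ (refl , E′⇒H e)

xor-≢ˡ : ∀ {a a′ b b′} → a ≢ a′ → b ≡ b′ → a xor b ≢ a′ xor b′
xor-≢ˡ {b = b} a≢a′ refl eq = a≢a′ (∙-cancelʳ b _ _ eq)

xor-≢ʳ : ∀ {a a′ b b′} → a ≡ a′ → b ≢ b′ → a xor b ≢ a′ xor b′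
xor-≢ʳ {a} refl b≢b′ eq = b≢b′ (∙-cancelˡ a _ _ eq)

vertex-≟ : (K : Graph) → DecidableEquality (V K)
vertex-≟ K = inj⇒≟ (↔⇒↣ (finite K))

module Hub {K : Graph} {k : ℕ} (M : OddModel K (suc k)) where
  open OddModel M

  root : V K
  root = proj₁ (IsTree.nonempty (isTree zero))

  root∈hub : inZ zero root
  root∈hub = proj₂ (IsTree.nonempty (isTree zero))

  spoke∉hub : ∀ {i x} → inZ (suc i) x → ¬ inZ zero x
  spoke∉hub x∈spoke x∈hub with disjoint x∈spoke x∈hub
  ... | ()

  private
    spokeEdge : ∀ i → Σ (V K) λ x → Σ (V K) λ y →
                inZ (suc i) x × inZ zero y × Adj K x y × colour x ≡ colour y
    spokeEdge i = oddEdge λ ()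

  foot anchor : Fin k → V K
  foot   i = proj₁ (spokeEdge i)
  anchor i = proj₁ (proj₂ (spokeEdge i))

  foot∈spoke : ∀ i → inZ (suc i) (foot i)
  foot∈spoke i = let (_ , _ , x∈ , _) = spokeEdge i in x∈

  anchor∈hub : ∀ i → inZ zero (anchor i)
  anchor∈hub i = let (_ , _ , _ , y∈ , _) = spokeEdge i in y∈

  foot-anchor-adjacent : ∀ i → Adj K (foot i) (anchor i)
  foot-anchor-adjacent i = let (_ , _ , _ , _ , xy , _) = spokeEdge i in xy

  foot-anchor-colour : ∀ i → colour (foot i) ≡ colour (anchor i)
  foot-anchor-colour i = let (_ , _ , _ , _ , _ , cxy) = spokeEdge i in cxy

  foot-injective : Injective _≡_ _≡_ foot
  foot-injective {i} {i′} eq =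
    suc-injective (disjoint (foot∈spoke i) (subst (inZ (suc i′)) (sym eq) (foot∈spoke i′)))

module Construction {G H : Graph} {m n : ℕ} (MG : OddModel G (suc m)) (MH : OddModel H (suc n)) where
  module MG = OddModel MG
  module MH = OddModel MH
  module HG = Hub MG
  module HH = Hub MH

  T : V H → Set
  T = WithLeaves (MH.inZ zero) HH.foot

  TE : V H → V H → Set
  TE = WithLeavesE (MH.treeE zero) HH.anchor HH.foot

  T-tree : IsTree T TE
  T-tree = IsTree-withLeaves HH.anchor HH.foot HH.anchor∈hub (HH.spoke∉hub ∘ HH.foot∈spoke)
             HH.foot-injective (MH.isTree zero)

  TE⇒H : TE ⇒ Adj H
  TE⇒H (inj₁ e)                           = MH.subgraph zero e
  TE⇒H (inj₂ (j , inj₁ (refl , refl)))    = Graph.sym H (HH.foot-anchor-adjacent j)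
  TE⇒H (inj₂ (j , inj₂ (refl , refl)))    = HH.foot-anchor-adjacent j

  Index : Set
  Index = Fin m ⊎ Fin n

  Z : Index → V G × V H → Set
  Z (inj₁ i) = Cross (MG.inZ (suc i)) T (HG.foot i) HH.root
  Z (inj₂ j) = Cross (MG.inZ zero) (MH.inZ (suc j)) HG.root (HH.foot j)

  ZE : Index → V G × V H → V G × V H → Set
  ZE (inj₁ i) = CrossE (MG.treeE (suc i)) TE (HG.foot i) HH.root
  ZE (inj₂ j) = CrossE (MG.treeE zero) (MH.treeE (suc j)) HG.root (HH.foot j)

  Z-tree : ∀ ι → IsTree (Z ι) (ZE ι)
  Z-tree (inj₁ i) = IsTree-cross (HG.foot∈spoke i) (inj₁ HH.root∈hub) (MG.isTree (suc i)) T-tree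
  Z-tree (inj₂ j) = IsTree-cross HG.root∈hub (HH.foot∈spoke j) (MG.isTree zero) (MH.isTree (suc j))

  Z-subgraph : ∀ ι → ZE ι ⇒ Adj (G □ H)
  Z-subgraph (inj₁ i) = CrossE-□ {G} {H} (MG.subgraph (suc i)) TE⇒H
  Z-subgraph (inj₂ j) = CrossE-□ {G} {H} (MG.subgraph zero) (MH.subgraph (suc j))

  Z-disjoint : ∀ {ι ι′ v} → Z ι v → Z ι′ v → ι ≡ ι′
  Z-disjoint {inj₁ i} {inj₁ i′} v∈ v∈′ =
    cong inj₁ (suc-injective
      (MG.disjoint (Cross-proj₁ (HG.foot∈spoke i) v∈) (Cross-proj₁ (HG.foot∈spoke i′) v∈′)))
  Z-disjoint {inj₁ i} {inj₂ j} v∈ v∈′ =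
    ⊥-elim (HG.spoke∉hub (Cross-proj₁ (HG.foot∈spoke i) v∈) (Cross-proj₁ HG.root∈hub v∈′))
  Z-disjoint {inj₂ j} {inj₁ i} v∈ v∈′ =
    ⊥-elim (HG.spoke∉hub (Cross-proj₁ (HG.foot∈spoke i) v∈′) (Cross-proj₁ HG.root∈hub v∈))
  Z-disjoint {inj₂ j} {inj₂ j′} v∈ v∈′ =
    cong inj₂ (suc-injective
      (MH.disjoint (Cross-proj₂ (HH.foot∈spoke j) v∈) (Cross-proj₂ (HH.foot∈spoke j′) v∈′)))

  flip : V G → V H → Bool
  flip x y = does (vertex-≟ G x HG.root) ∨ does (any? λ j → vertex-≟ H y (HH.foot j))

  flip-root : ∀ y → flip HG.root y ≡ true
  flip-root y rewrite dec-true (vertex-≟ G HG.root HG.root) refl = refl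

  flip-foot : ∀ x j → flip x (HH.foot j) ≡ true
  flip-foot x j rewrite dec-true (any? λ j′ → vertex-≟ H (HH.foot j) (HH.foot j′)) (j , refl) = ∨-zeroʳ _

  flip-spoke-hub : ∀ {i x y} → MG.inZ (suc i) x → MH.inZ zero y → flip x y ≡ false
  flip-spoke-hub {x = x} {y} x∈spoke y∈hub
    rewrite dec-false (vertex-≟ G x HG.root) (λ { refl → HG.spoke∉hub x∈spoke HG.root∈hub })
          | dec-false (any? λ j → vertex-≟ H y (HH.foot j))
                      (λ { (j , refl) → HH.spoke∉hub (HH.foot∈spoke j) y∈hub })
    = refl

  colour : V G × V H → Bool
  colour (x , y) = (MG.colour x xor MH.colour y) xor flip x y

  colour-≢ᴳ : ∀ {x x′ y} → MG.colour x ≢ MG.colour x′ → flip x y ≡ flip x′ y →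
              colour (x , y) ≢ colour (x′ , y)
  colour-≢ᴳ cx≢cx′ = xor-≢ˡ (xor-≢ˡ cx≢cx′ refl)

  colour-≢ᴴ : ∀ {x y y′} → MH.colour y ≢ MH.colour y′ → flip x y ≡ flip x y′ →
              colour (x , y) ≢ colour (x , y′)
  colour-≢ᴴ {x} cy≢cy′ = xor-≢ˡ (xor-≢ʳ {MG.colour x} refl cy≢cy′)

  colour-≢-flip : ∀ {x y y′} → MH.colour y ≡ MH.colour y′ → flip x y ≢ flip x y′ →
                  colour (x , y) ≢ colour (x , y′)
  colour-≢-flip {x} cy≡cy′ = xor-≢ʳ (cong (MG.colour x xor_) cy≡cy′)

  colour-≡ : ∀ {x x′ y y′} → MG.colour x ≡ MG.colour x′ → MH.colour y ≡ MH.colour y′ →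
             flip x y ≡ flip x′ y′ → colour (x , y) ≡ colour (x′ , y′)
  colour-≡ cx≡cx′ cy≡cy′ = cong₂ _xor_ (cong₂ _xor_ cx≡cx′ cy≡cy′)

  leaf-edge-flips : ∀ i j → flip (HG.foot i) (HH.anchor j) ≢ flip (HG.foot i) (HH.foot j)
  leaf-edge-flips i j
    rewrite flip-spoke-hub (HG.foot∈spoke i) (HH.anchor∈hub j) | flip-foot (HG.foot i) j = λ ()

  Z-proper : ∀ ι {u v} → ZE ι u v → colour u ≢ colour v
  Z-proper (inj₁ i) (inj₁ (x , x′ , e , refl , refl)) =
    let (x∈ , x′∈) = IsTree.inside (MG.isTree (suc i)) e in
    colour-≢ᴳ (MG.proper (suc i) e)
      (trans (flip-spoke-hub x∈ HH.root∈hub) (sym (flip-spoke-hub x′∈ HH.root∈hub)))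
  Z-proper (inj₁ i) (inj₂ (y , y′ , inj₁ e , refl , refl)) =
    let (y∈ , y′∈) = IsTree.inside (MH.isTree zero) e in
    colour-≢ᴴ (MH.proper zero e)
      (trans (flip-spoke-hub (HG.foot∈spoke i) y∈) (sym (flip-spoke-hub (HG.foot∈spoke i) y′∈)))
  Z-proper (inj₁ i) (inj₂ (_ , _ , inj₂ (j , inj₁ (refl , refl)) , refl , refl)) =
    colour-≢-flip (sym (HH.foot-anchor-colour j)) (leaf-edge-flips i j)
  Z-proper (inj₁ i) (inj₂ (_ , _ , inj₂ (j , inj₂ (refl , refl)) , refl , refl)) =
    colour-≢-flip (HH.foot-anchor-colour j) (leaf-edge-flips i j ∘ sym)
  Z-proper (inj₂ j) (inj₁ (x , x′ , e , refl , refl)) =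
    colour-≢ᴳ (MG.proper zero e) (trans (flip-foot x j) (sym (flip-foot x′ j)))
  Z-proper (inj₂ j) (inj₂ (y , y′ , e , refl , refl)) =
    colour-≢ᴴ (MH.proper (suc j) e) (trans (flip-root y) (sym (flip-root y′)))

  OddEdge : Index → Index → Set
  OddEdge ι ι′ = Σ (V G × V H) λ u → Σ (V G × V H) λ v →
                 Z ι u × Z ι′ v × □Adj G H u v × colour u ≡ colour v

  OddEdge-sym : ∀ {ι ι′} → OddEdge ι ι′ → OddEdge ι′ ι
  OddEdge-sym (u , v , u∈ , v∈ , uv , cu≡cv) = v , u , v∈ , u∈ , □sym G H uv , sym cu≡cv

  Z-odd : ∀ ι ι′ → ι ≢ ι′ → OddEdge ι ι′
  Z-odd (inj₁ i) (inj₁ i′) i≢i′ =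
    let (x , x′ , x∈ , x′∈ , xx′ , cx≡cx′) = MG.oddEdge (i≢i′ ∘ cong inj₁ ∘ suc-injective) in
    (x , HH.root) , (x′ , HH.root) , inj₁ (x , x∈ , refl) , inj₁ (x′ , x′∈ , refl) , inj₂ (refl , xx′) ,
    colour-≡ cx≡cx′ refl (trans (flip-spoke-hub x∈ HH.root∈hub) (sym (flip-spoke-hub x′∈ HH.root∈hub)))
  Z-odd (inj₁ i) (inj₂ j) _ =
    (HG.foot i , HH.foot j) , (HG.anchor i , HH.foot j) ,
    inj₂ (HH.foot j , inj₂ (j , refl) , refl) , inj₁ (HG.anchor i , HG.anchor∈hub i , refl) ,
    inj₂ (refl , HG.foot-anchor-adjacent i) ,
    colour-≡ (HG.foot-anchor-colour i) refl
      (trans (flip-foot (HG.foot i) j) (sym (flip-foot (HG.anchor i) j)))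
  Z-odd (inj₂ j) (inj₁ i) _ = OddEdge-sym {inj₁ i} {inj₂ j} (Z-odd (inj₁ i) (inj₂ j) λ ())
  Z-odd (inj₂ j) (inj₂ j′) j≢j′ =
    let (y , y′ , y∈ , y′∈ , yy′ , cy≡cy′) = MH.oddEdge (j≢j′ ∘ cong inj₂ ∘ suc-injective) in
    (HG.root , y) , (HG.root , y′) , inj₂ (y , y∈ , refl) , inj₂ (y′ , y′∈ , refl) , inj₁ (refl , yy′) ,
    colour-≡ refl cy≡cy′ (trans (flip-root y) (sym (flip-root y′)))

oddModel-□ : ∀ {G H m n} → OddModel G (suc m) → OddModel H (suc n) → OddModel (G □ H) (m + n)
oddModel-□ {m = m} {n} MG MH = record
  { inZ      = Z ∘ split
  ; treeE    = ZE ∘ split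
  ; colour   = colour
  ; isTree   = Z-tree ∘ split
  ; subgraph = Z-subgraph ∘ split
  ; disjoint = λ v∈ v∈′ → split-injective (Z-disjoint v∈ v∈′)
  ; proper   = Z-proper ∘ split
  ; oddEdge  = λ k≢k′ → Z-odd _ _ (k≢k′ ∘ split-injective)
  }
  where
    open Construction MG MH
    split : Fin (m + n) → Index
    split = Inverse.to +↔⊎
    split-injective : Injective _≡_ _≡_ split
    split-injective = Injection.injective (↔⇒↣ +↔⊎)

theorem2 : (G H : Graph) (s t : ℕ) → 2 ≤ s → 2 ≤ t →
           OhEq G s → OhEq H t → OhGeq (G □ H) (s + t ∸ 2)
theorem2 G H (suc m) (suc n) (s≤s _) (s≤s _) (MG , _) (MH , _) =
  m + n , ≤-reflexive (cong (_∸ 1) (+-suc m n)) , oddModel-□ MG MH
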